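{- Let $\Delta$ be a finite pure simplicial complex. Then the following are equivalent: (1) $\Delta$ admits projection maps satisfying the projection axioms (P1)–(P3); (2) $\Delta$ admits restriction maps satisfying the restriction axioms (R1)–(R3); (3) $\Delta$ admits partial orders satisfying the shelling axioms (S1)–(S3).
   Context: Let $\mathcal{F}$ be the set of faces of $\Delta$ (including the empty face $\emptyset$) and $\mathcal{C}$ the set of chambers (maximal faces). $F\le G$ means $F$ is a face of $G$; $G\lessdot D$ means $G$ is a codimension-one face of $D$. $\mathcal{C}_{\geq F}$ is the set of chambers containing $F$. A shelling of $\Delta$ (of dimension $d$) is a linear order $\le_S$ on $\mathcal{C}$ such that for every chamber $D$ other than the first, $D\cap\bigcup_{E<_SD}E$ is a nonempty union of codimension-one faces of $D$. Projection axioms (P): there is a map $\mathcal{F}\times\mathcal{C}\to\mathcal{C}$, $(F,C)\mapsto FC$, such that (P1)(i) if $FC=D$ then $F\le D$; (ii) if $F\le C$ then $FC=C$; (iii) if $FC=D$ and $F\le G\le D$ then $GC=D$. (P2) if $F\le D$ and $GC=D$ for all $G$ with $F\le G\lessdot D$, then $FC=D$. (P3) if $FC=D$ and $C_1,\dots,C_n=D$ is a weak $C$-gallery, then $FC_1=D$. Here a weak $C$-gallery is a sequence of chambers $C_1,\dots,C_n$ together with faces $F_1,\dots,F_{n-1}$ such that $F_iC=C_i$ and $F_i\le C_i$, $F_i\le C_{i+1}$ for each $i$. Restriction axioms (R): for every $C\in\mathcal{C}$ there is a map $R_C:\mathcal{C}\to\mathcal{F}$ such that (R1) $R_C(C)=\emptyset$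 and $R_C(D)\le D$ for all $C,D$; (R2) for every $C$, $\mathcal{F}$ is the disjoint union over $D\in\mathcal{C}$ of the sets $\{F\in\mathcal{F}: R_C(D)\le F\le D\}$; (R3) if $C_1,\dots,C_n=D$ are chambers with $R_C(C_i)\le C_{i+1}$ for $1\le i\le n-1$, then $R_{C_1}(D)\le R_C(D)\le D$. Shelling axioms (S): for every $C\in\mathcal{C}$ there is a partial order $\le_C$ on $\mathcal{C}$ such that (S1) for every $F\in\mathcal{F}$ the restriction of $\le_C$ to $\mathcal{C}_{\ge F}$ has a unique minimal element, which for $F=\emptyset$ is $C$; (S2) every linear extension of $\le_C$ is a shelling of $\Delta$; (S3) if $D\le_C D_1\le_C D_2$ then $D_1\le_D D_2$. -}

module Defs where

open import Data.Nat using (ℕ; suc; _<_)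
open import Data.Bool using (Bool; T)
open import Data.Fin using (Fin; toℕ)
open import Data.Fin.Subset using (Subset; _⊆_; _∩_; ⊥; ∣_∣)
open import Data.List using (List; length; lookup)
open import Data.List.Membership.Propositional using (_∈_)
open import Data.List.Relation.Unary.All using (All)
open import Data.List.Relation.Unary.Unique.Propositional using (Unique)
open import Data.Product using (Σ; ∃; ∃-syntax; _×_)
open import Relation.Binary.PropositionalEquality using (_≡_)

-- Finite simplicial complexes on the vertex set Fin n.
-- A face is a subset of the vertex set; F ≤ G is F ⊆ G.

record Complex : Set where
  field
    n          : ℕ
    isFace     : Subset n → Bool
    emptyFace  : T (isFace ⊥)
    downClosed : ∀ {s t} → T (isFace t) → s ⊆ t → T (isFace s)

module _ (Δ : Complex) where
  open Complex Δ

  V : Set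
  V = Subset n

  Face : V → Set
  Face s = T (isFace s)

  Chamber : V → Set
  Chamber s = Face s × (∀ t → Face t → s ⊆ t → t ≡ s)

  Pure : Set
  Pure = ∀ C D → Chamber C → Chamber D → ∣ C ∣ ≡ ∣ D ∣

  _⋖_ : V → V → Set
  G ⋖ D = G ⊆ D × suc ∣ G ∣ ≡ ∣ D ∣

  -- Linear orders on the set of chambers, given as duplicate-free lists
  -- enumerating exactly the chambers (earlier in the list = smaller).

  record ChamberOrder : Set where
    field
      list     : List V
      allCh    : All Chamber list
      complete : ∀ C → Chamber C → C ∈ list
      unique   : Unique list

  -- Shelling: for every chamber D (other than the first) and every
  -- earlier chamber E, the face D ∩ E lies in some codimension-one face
  -- G of D which itself lies in some earlier chamber.  Hence
  -- D ∩ ⋃_{E <_S D} E is a union of codimension-one faces of D, and it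
  -- is nonempty (as a complex) since D is not first.
  IsShelling : ChamberOrder → Set
  IsShelling O =
    ∀ (j i : Fin (length list)) → toℕ i < toℕ j →
      ∃[ G ] (G ⋖ lookup list j
             × (lookup list j ∩ lookup list i) ⊆ G
             × ∃[ k ] (toℕ k < toℕ j × G ⊆ lookup list k))
    where open ChamberOrder O

  IsLinearExtension : (V → V → Set) → ChamberOrder → Set
  IsLinearExtension _≤C_ O =
    ∀ (i j : Fin (length list)) → lookup list i ≤C lookup list j → toℕ i Data.Nat.≤ toℕ j
    where open ChamberOrder O

  IsPartialOrderOnChambers : (V → V → Set) → Set
  IsPartialOrderOnChambers _≤C_ =
      (∀ D → Chamber D → D ≤C D)
    × (∀ D E → Chamber D → Chamber E → D ≤C E → E ≤C D → D ≡ E)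
    × (∀ D E K → Chamber D → Chamber E → Chamber K → D ≤C E → E ≤C K → D ≤C K)

  -- Projection axioms.  proj F C stands for FC.

  data WeakGallery (proj : V → V → V) (C : V) : V → V → Set where
    single : ∀ {D} → Chamber D → WeakGallery proj C D D
    step   : ∀ {C₁ C₂ D} F → Chamber C₁ → Face F → proj F C ≡ C₁ →
             F ⊆ C₁ → F ⊆ C₂ → WeakGallery proj C C₂ D →
             WeakGallery proj C C₁ D

  ProjectionAxioms : (V → V → V) → Set
  ProjectionAxioms proj =
      (∀ F C → Face F → Chamber C → Chamber (proj F C))
    × (∀ F C → Face F → Chamber C → F ⊆ proj F C)
    × (∀ F C → Face F → Chamber C → F ⊆ C → proj F C ≡ C)
    × (∀ F G C D → Face F → Face G → Chamber C → Chamber D →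
         proj F C ≡ D → F ⊆ G → G ⊆ D → proj G C ≡ D)
    × (∀ F C D → Face F → Chamber C → Chamber D → F ⊆ D →
         (∀ G → Face G → F ⊆ G → G ⋖ D → proj G C ≡ D) → proj F C ≡ D)
    × (∀ F C C₁ D → Face F → Chamber C → Chamber D →
         proj F C ≡ D → WeakGallery proj C C₁ D → proj F C₁ ≡ D)

  HasProjections : Set
  HasProjections = Σ (V → V → V) ProjectionAxioms

  -- Restriction axioms.  res C D stands for R_C(D).

  data RChain (res : V → V → V) (C : V) : V → V → Set where
    single : ∀ {D} → Chamber D → RChain res C D D
    step   : ∀ {C₁ C₂ D} → Chamber C₁ → res C C₁ ⊆ C₂ →
             RChain res C C₂ D → RChain res C C₁ D

  RestrictionAxioms : (V → V → V) → Set
  RestrictionAxioms res =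
      (∀ C D → Chamber C → Chamber D → Face (res C D))
    × (∀ C → Chamber C → res C C ≡ ⊥)
    × (∀ C D → Chamber C → Chamber D → res C D ⊆ D)
    × (∀ C F → Chamber C → Face F →
         ∃[ D ] ((Chamber D × res C D ⊆ F × F ⊆ D)
                × (∀ D′ → Chamber D′ → res C D′ ⊆ F → F ⊆ D′ → D′ ≡ D)))
    × (∀ C C₁ D → Chamber C → RChain res C C₁ D →
         res C₁ D ⊆ res C D)

  HasRestrictions : Set
  HasRestrictions = Σ (V → V → V) RestrictionAxioms

  -- Shelling axioms.  D ≤[ C ] E is written ord C D E.

  MinimalAbove : (V → V → Set) → V → V → Set
  MinimalAbove _≤C_ F m =
    Chamber m × F ⊆ m × (∀ E → Chamber E → F ⊆ E → E ≤C m → E ≡ m)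

  ShellingAxioms : (V → V → V → Set) → Set
  ShellingAxioms ord =
      (∀ C → Chamber C → IsPartialOrderOnChambers (ord C))
    × (∀ C F → Chamber C → Face F →
         ∃[ m ] (MinimalAbove (ord C) F m
                × (∀ m′ → MinimalAbove (ord C) F m′ → m′ ≡ m)))
    × (∀ C → Chamber C → MinimalAbove (ord C) ⊥ C)
    × (∀ C → Chamber C → (O : ChamberOrder) →
         IsLinearExtension (ord C) O → IsShelling O)
    × (∀ C D D₁ D₂ → Chamber C → Chamber D → Chamber D₁ → Chamber D₂ →
         ord C D D₁ → ord C D₁ D₂ → ord D D₁ D₂)

  HasShellingOrders : Set₁
  HasShellingOrders = Σ (V → V → V → Set) ShellingAxioms

-- Projections and restrictions determine each other: R_C(D) is the set of
-- vertices v of D whose facet D − v does not project to D, and FC is the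
-- unique chamber D with R_C(D) ≤ F ≤ D.  By (P1)(iii) and (P2), a face
-- F ≤ D has FC = D exactly when R_C(D) ≤ F, and under this dictionary weak
-- C-galleries become chains C₁, …, Cₙ with R_C(Cᵢ) ≤ Cᵢ₊₁, so the two sets
-- of axioms translate into each other.  Such chains from D to E define the
-- shelling order D ≤_C E: (R3) makes it antisymmetric and gives (S3), and
-- (R2) makes the chamber carrying F the least chamber above F, giving (S1).
-- A linear extension is a shelling because a vertex v of R_C(D) outside an
-- earlier chamber E yields the facet D − v, carried by a chamber before D.
-- Conversely, from shelling orders FC is the ≤_C-minimal chamber above F;
-- (P2) follows by applying the shelling property of a linear extension of
-- ≤_C to FC ≠ D, and (P3) from (S3).

module Submission where

open import Data.Bool using (true; false)
open import Data.Bool.Properties using (T?)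
import Data.Bool.Properties as Bool
open import Data.Fin using (Fin; zero; suc; toℕ)
open import Data.Fin.Properties using (toℕ-injective; ¬∀⟶∃¬)
open import Data.Fin.Subset
  using (Subset; inside; outside; _∈_; _∉_; _⊆_; _⊈_; _-_; _∩_; ∣_∣; ⊥)
open import Data.Fin.Subset.Properties
  using (_∈?_; _⊆?_; ⊆-refl; ⊆-trans; ⊆-antisym; ⊆-min; p─⊥≡p; p─q⊆p; x∈p∧x≢y⇒x∈p-y;
         p⊂q⇒∣p∣<∣q∣; p⊆q⇒∣p∣≤∣q∣; x∈p∩q⁺; p∩q⊆p; p∩q⊆q; anySubset?)
open import Data.List using (List; []; _∷_; map; filter; length; lookup)
import Data.List as List
open import Data.List.Membership.Propositional using () renaming (_∈_ to _∈ₗ_)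
open import Data.List.Membership.Propositional.Properties
  using (∈-lookup; ∈-filter⁺; ∈-filter⁻; ∈-++⁺ˡ; ∈-++⁺ʳ; ∈-map⁺)
open import Data.List.Properties using (filter-notAll)
open import Data.List.Relation.Unary.All as All using (All; []; _∷_)
open import Data.List.Relation.Unary.All.Properties
  using (all-filter) renaming (filter⁺ to All-filter⁺)
open import Data.List.Relation.Unary.AllPairs as AllPairs using (AllPairs; []; _∷_)
import Data.List.Relation.Unary.Any as Any
open import Data.List.Relation.Unary.Any.Properties using (lookup-index)
open import Data.Nat using (zero; suc; _≤_; _<_; s≤s)
open import Data.Nat.Properties
  using (<-irrefl; ≤-refl; ≤-trans; ≤-pred; suc-injective; ≮⇒≥; ≤∧≢⇒<; <⇒≱)
open import Data.Product using (Σ; ∃; ∃-syntax; _×_; _,_; proj₁; proj₂; map₂)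
open import Data.Vec using (_∷_; []; here; there; tabulate)
open import Data.Vec.Properties using (lookup∘tabulate; []=⇒lookup; lookup⇒[]=; ≡-dec)
open import Function.Base using (_∘_)
open import Function.Bundles using (_⇔_; mk⇔)
open import Relation.Binary.Definitions using (DecidableEquality; Decidable)
open import Relation.Binary.PropositionalEquality
  using (_≡_; _≢_; refl; sym; trans; cong; subst)
open import Relation.Nullary
  using (Dec; yes; no; does; ¬_; ¬?; contradiction; _×-dec_; _→-dec_)
open import Relation.Nullary.Decidable using (dec-true; decidable-stable; ¬¬-excluded-middle)

open import Defs

_≟ₛ_ : ∀ {n} → DecidableEquality (Subset n)
_≟ₛ_ = ≡-dec Bool._≟_

x∈p⇒suc∣p-x∣≡∣p∣ : ∀ {n} {x : Fin n} {p : Subset n} → x ∈ p → suc ∣ p - x ∣ ≡ ∣ p ∣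
x∈p⇒suc∣p-x∣≡∣p∣ {x = zero}  {inside ∷ p}  here      = cong suc (cong ∣_∣ (p─⊥≡p p))
x∈p⇒suc∣p-x∣≡∣p∣ {x = suc x} {inside ∷ p}  (there h) = cong suc (x∈p⇒suc∣p-x∣≡∣p∣ h)
x∈p⇒suc∣p-x∣≡∣p∣ {x = suc x} {outside ∷ p} (there h) = x∈p⇒suc∣p-x∣≡∣p∣ h

x∉p-x : ∀ {n} {x : Fin n} (p : Subset n) → x ∉ p - x
x∉p-x {x = suc x} (_ ∷ p) (there h) = x∉p-x p h

p-x⊆p : ∀ {n} (p : Subset n) (x : Fin n) → p - x ⊆ p
p-x⊆p p x = p─q⊆p p _

p⊆q∧x∉p⇒p⊆q-x : ∀ {n} {x : Fin n} {p q : Subset n} → p ⊆ q → x ∉ p → p ⊆ q - x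
p⊆q∧x∉p⇒p⊆q-x p⊆q x∉p y∈p = x∈p∧x≢y⇒x∈p-y (p⊆q y∈p) λ { refl → x∉p y∈p }

p⊈q⇒∃∈∉ : ∀ {n} {p q : Subset n} → p ⊈ q → ∃[ x ] (x ∈ p × x ∉ q)
p⊈q⇒∃∈∉ {p = p} {q} p⊈q =
  let x , ¬[x∈p⇒x∈q] = ¬∀⟶∃¬ _ (λ x → x ∈ p → x ∈ q) (λ x → x ∈? p →-dec x ∈? q) (λ ∀x → p⊈q (∀x _))
  in x , decidable-stable (x ∈? p) (λ x∉p → ¬[x∈p⇒x∈q] (λ x∈p → contradiction x∈p x∉p))
       , (λ x∈q → ¬[x∈p⇒x∈q] (λ _ → x∈q))

select : ∀ {n} {P : Fin n → Set} → (∀ x → Dec (P x)) → Subset n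
select P? = tabulate (λ x → does (P? x))

∈-select⁺ : ∀ {n} {P : Fin n → Set} (P? : ∀ x → Dec (P x)) {x} → P x → x ∈ select P?
∈-select⁺ P? {x} px = lookup⇒[]= x _ (trans (lookup∘tabulate _ x) (dec-true (P? x) px))

∈-select⁻ : ∀ {n} {P : Fin n → Set} (P? : ∀ x → Dec (P x)) {x} → x ∈ select P? → P x
∈-select⁻ P? {x} x∈ with P? x | trans (sym (lookup∘tabulate _ x)) ([]=⇒lookup x∈)
... | yes px | _ = px
... | no _   | ()

∀-Subset? : ∀ {n} {P : Subset n → Set} → (∀ p → Dec (P p)) → Dec (∀ p → P p)
∀-Subset? P? with anySubset? (λ p → ¬? (P? p))
... | yes (p , ¬Pp) = no λ ∀P → ¬Pp (∀P p)
... | no ∄¬P        = yes λ p → decidable-stable (P? p) λ ¬Pp → ∄¬P (p , ¬Pp)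

¬¬-∀-Subset : ∀ {n} {P : Subset n → Set} → (∀ p → ¬ ¬ P p) → ¬ ¬ (∀ p → P p)
¬¬-∀-Subset {zero}  ¬¬P k = ¬¬P [] λ P[] → k λ { [] → P[] }
¬¬-∀-Subset {suc n} ¬¬P k =
  ¬¬-∀-Subset (λ p → ¬¬P (inside ∷ p)) λ Pin →
  ¬¬-∀-Subset (λ p → ¬¬P (outside ∷ p)) λ Pout →
  k λ { (true ∷ p) → Pin p ; (false ∷ p) → Pout p }

allSubsets : ∀ n → List (Subset n)
allSubsets zero    = [] ∷ []
allSubsets (suc n) = map (inside ∷_) (allSubsets n) List.++ map (outside ∷_) (allSubsets n)

∈-allSubsets : ∀ {n} (p : Subset n) → p ∈ₗ allSubsets n
∈-allSubsets []         = Any.here refl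
∈-allSubsets (true ∷ p) = ∈-++⁺ˡ (∈-map⁺ (inside ∷_) (∈-allSubsets p))
∈-allSubsets {suc n} (false ∷ p) =
  ∈-++⁺ʳ (map (inside ∷_) (allSubsets n)) (∈-map⁺ (outside ∷_) (∈-allSubsets p))

p⊆q∧∣p∣≡∣q∣⇒p≡q : ∀ {n} {p q : Subset n} → p ⊆ q → ∣ p ∣ ≡ ∣ q ∣ → p ≡ q
p⊆q∧∣p∣≡∣q∣⇒p≡q {p = p} p⊆q ∣p∣≡∣q∣ = ⊆-antisym p⊆q λ {x} x∈q →
  decidable-stable (x ∈? p) λ x∉p → <-irrefl ∣p∣≡∣q∣ (p⊂q⇒∣p∣<∣q∣ (p⊆q , x , x∈q , x∉p))

AllPairs-lookup : ∀ {A : Set} {R : A → A → Set} {xs : List A} → AllPairs R xs →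
                  ∀ {i j} → toℕ i < toℕ j → R (lookup xs i) (lookup xs j)
AllPairs-lookup (Rx ∷ _)   {zero}  {suc j} _         = All.lookup Rx (∈-lookup j)
AllPairs-lookup (_  ∷ Rxs) {suc i} {suc j} (s≤s i<j) = AllPairs-lookup Rxs i<j

module FinitePoset
  {A : Set} (_≟_ : DecidableEquality A) {P : A → Set}
  (_≼_ : A → A → Set) (_≼?_ : Decidable _≼_)
  (≼-refl : ∀ {x} → P x → x ≼ x)
  (≼-antisym : ∀ {x y} → P x → P y → x ≼ y → y ≼ x → x ≡ y)
  (≼-trans : ∀ {x y z} → P x → P y → P z → x ≼ y → y ≼ z → x ≼ z)
  where

  IsMinimalIn : List A → A → Set
  IsMinimalIn xs m = m ∈ₗ xs × (∀ {y} → y ∈ₗ xs → y ≼ m → y ≡ m)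

  minimal : ∀ {x xs} → x ∈ₗ xs → All P xs → ∃ (IsMinimalIn xs)
  minimal {xs = x ∷ []}      _ _         = x , Any.here refl , λ { (Any.here refl) _ → refl }
  minimal {xs = x ∷ x′ ∷ xs} _ (px ∷ ps) with minimal (Any.here refl) ps
  ... | m , m∈ , m-min with x ≼? m
  ...   | no x⋠m  = m , Any.there m∈ , λ
    { (Any.here refl) x≼m → contradiction x≼m x⋠m
    ; (Any.there y∈)       → m-min y∈ }
  ...   | yes x≼m = x , Any.here refl , λ
    { (Any.here refl) _   → refl
    ; (Any.there y∈)  y≼x → x-min y∈ y≼x }
    where
    pm = All.lookup ps m∈
    x-min : ∀ {y} → y ∈ₗ x′ ∷ xs → y ≼ x → y ≡ x
    x-min y∈ y≼x with m-min y∈ (≼-trans (All.lookup ps y∈) px pm y≼x x≼m)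
    ... | refl = ≼-antisym pm px y≼x x≼m

  IsMinimalBelow : (A → Set) → List A → A → A → Set
  IsMinimalBelow Q xs e m = m ∈ₗ xs × Q m × m ≼ e × (∀ {y} → y ∈ₗ xs → Q y → y ≼ m → y ≡ m)

  minimalBelow : ∀ {Q : A → Set} (Q? : ∀ x → Dec (Q x)) {xs e} →
                 All P xs → e ∈ₗ xs → Q e → ∃ (IsMinimalBelow Q xs e)
  minimalBelow {Q} Q? {xs} {e} ps e∈ Qe =
    below-minimal (minimal (∈-filter⁺ below? e∈ (Qe , ≼-refl pe)) (All-filter⁺ below? ps))
    where
    below? = λ x → Q? x ×-dec x ≼? e
    pe = All.lookup ps e∈
    below-minimal : ∃ (IsMinimalIn (filter below? xs)) → ∃ (IsMinimalBelow Q xs e)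
    below-minimal (m , m∈ , m-min) with ∈-filter⁻ below? m∈
    ... | m∈xs , Qm , m≼e = m , m∈xs , Qm , m≼e , λ y∈ Qy y≼m →
      let y≼e = ≼-trans (All.lookup ps y∈) (All.lookup ps m∈xs) pe y≼m m≼e
      in m-min (∈-filter⁺ below? y∈ (Qy , y≼e)) y≼m

  record LinearExtension (xs : List A) : Set where
    field
      list   : List A
      ⊇xs    : ∀ {z} → z ∈ₗ xs → z ∈ₗ list
      ⊆xs    : ∀ {z} → z ∈ₗ list → z ∈ₗ xs
      sorted : AllPairs (λ x y → x ≢ y × ¬ y ≼ x) list

  linearExtension : ∀ xs → All P xs → LinearExtension xs
  linearExtension xs = sort (length xs) xs ≤-refl
    where
    sort : ∀ k xs → length xs ≤ k → All P xs → LinearExtension xs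
    sort _       []       _            _  =
      record { list = [] ; ⊇xs = λ () ; ⊆xs = λ () ; sorted = [] }
    sort (suc k) (x ∷ xs) (s≤s ∣xs∣≤k) ps with minimal (Any.here refl) ps
    ... | m , m∈ , m-min = record
      { list   = m ∷ list
      ; ⊇xs    = ⊇xs′
      ; ⊆xs    = λ { (Any.here refl) → m∈ ; (Any.there z∈) → ∈-others (⊆xs z∈) }
      ; sorted = All.tabulate (λ y∈ → m≢y y∈ , m-below y∈) ∷ sorted
      }
      where
      ≢m? = λ y → ¬? (y ≟ m)
      others = filter ≢m? (x ∷ xs)
      ∈-others : ∀ {z} → z ∈ₗ others → z ∈ₗ x ∷ xs
      ∈-others z∈ = proj₁ (∈-filter⁻ ≢m? z∈)
      ∣others∣<∣x∷xs∣ : length others < length (x ∷ xs)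
      ∣others∣<∣x∷xs∣ = filter-notAll ≢m? (x ∷ xs) (Any.map (λ { refl m≢m → m≢m refl }) m∈)
      ∣others∣≤k : length others ≤ k
      ∣others∣≤k = ≤-pred (≤-trans ∣others∣<∣x∷xs∣ (s≤s ∣xs∣≤k))
      open LinearExtension (sort k others ∣others∣≤k (All-filter⁺ ≢m? ps))
      ⊇xs′ : ∀ {z} → z ∈ₗ x ∷ xs → z ∈ₗ m ∷ list
      ⊇xs′ {z} z∈ with z ≟ m
      ... | yes refl = Any.here refl
      ... | no z≢m   = Any.there (⊇xs (∈-filter⁺ ≢m? z∈ z≢m))
      m≢y : ∀ {y} → y ∈ₗ list → m ≢ y
      m≢y y∈ m≡y = proj₂ (∈-filter⁻ ≢m? (⊆xs y∈)) (sym m≡y)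
      m-below : ∀ {y} → y ∈ₗ list → ¬ y ≼ m
      m-below y∈ y≼m = m≢y y∈ (sym (m-min (∈-others (⊆xs y∈)) y≼m))

module _ (Δ : Complex) where
  open Complex Δ

  D-v⋖D : ∀ {D v} → v ∈ D → _⋖_ Δ (D - v) D
  D-v⋖D {D} {v} v∈D = p-x⊆p D v , x∈p⇒suc∣p-x∣≡∣p∣ v∈D

  ⋖⇒≡D-v : ∀ {G D} → _⋖_ Δ G D → ∃[ v ] (v ∈ D × G ≡ D - v)
  ⋖⇒≡D-v {G} {D} (G⊆D , suc∣G∣≡∣D∣) =
    let v , v∈D , v∉G = p⊈q⇒∃∈∉ D⊈G
        ∣G∣≡∣D-v∣ = suc-injective (trans suc∣G∣≡∣D∣ (sym (x∈p⇒suc∣p-x∣≡∣p∣ v∈D)))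
    in v , v∈D , p⊆q∧∣p∣≡∣q∣⇒p≡q (p⊆q∧x∉p⇒p⊆q-x G⊆D v∉G) ∣G∣≡∣D-v∣
    where
    D⊈G : D ⊈ G
    D⊈G D⊆G = <-irrefl refl (subst (_≤ ∣ G ∣) (sym suc∣G∣≡∣D∣) (p⊆q⇒∣p∣≤∣q∣ D⊆G))

  ⊆chamber⇒face : ∀ {F D} → Chamber Δ D → F ⊆ D → Face Δ F
  ⊆chamber⇒face (D-face , _) = downClosed D-face

  minimalAbove-⊆ : ∀ {_≼_ F G m} → F ⊆ G → G ⊆ m → MinimalAbove Δ _≼_ F m → MinimalAbove Δ _≼_ G m
  minimalAbove-⊆ F⊆G G⊆m (m-ch , _ , m-min) =
    m-ch , G⊆m , λ E E-ch G⊆E → m-min E E-ch (⊆-trans F⊆G G⊆E)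

  InInterval : (Subset n → Subset n → Subset n) → Subset n → Subset n → Subset n → Set
  InInterval res C F D = Chamber Δ D × res C D ⊆ F × F ⊆ D

  gallery-start : ∀ {proj C C₁ D} → WeakGallery Δ proj C C₁ D → Chamber Δ C₁
  gallery-start (single C₁-ch)           = C₁-ch
  gallery-start (step _ C₁-ch _ _ _ _ _) = C₁-ch

  rchain-start : ∀ {res C C₁ D} → RChain Δ res C C₁ D → Chamber Δ C₁
  rchain-start (single C₁-ch)   = C₁-ch
  rchain-start (step C₁-ch _ _) = C₁-ch

  rchain-end : ∀ {res C C₁ D} → RChain Δ res C C₁ D → Chamber Δ D
  rchain-end (single D-ch)  = D-ch
  rchain-end (step _ _ chain) = rchain-end chain

  chamber? : ∀ s → Dec (Chamber Δ s)
  chamber? s = T? (isFace s) ×-dec ∀-Subset? λ t → T? (isFace t) →-dec (s ⊆? t →-dec t ≟ₛ s)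

  chambers : List (Subset n)
  chambers = filter chamber? (allSubsets n)

  ∈-chambers : ∀ {C} → Chamber Δ C → C ∈ₗ chambers
  ∈-chambers {C} C-ch = ∈-filter⁺ chamber? (∈-allSubsets C) C-ch

  chambers-chamber : All (Chamber Δ) chambers
  chambers-chamber = all-filter chamber? (allSubsets n)

  module _ (O : ChamberOrder Δ) where
    open ChamberOrder O

    position : ∀ {D} → Chamber Δ D → ∃[ i ] (lookup list i ≡ D)
    position D-ch = Any.index D∈ , sym (lookup-index D∈)
      where D∈ = complete _ D-ch

    linearExtension-< : ∀ _≼_ → IsLinearExtension Δ _≼_ O → ∀ {i j} →
                        lookup list i ≼ lookup list j → lookup list i ≢ lookup list j → toℕ i < toℕ j
    linearExtension-< _ lin {i} {j} i≼j i≢j =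
      ≤∧≢⇒< (lin i j i≼j) λ i≡j → i≢j (cong (lookup list) (toℕ-injective i≡j))

    shelling⇒facet :
      ∀ _≼_ → IsLinearExtension Δ _≼_ O → IsShelling Δ O →
      ∀ {D E} → Chamber Δ D → Chamber Δ E → E ≼ D → E ≢ D →
      ∃[ G ] (_⋖_ Δ G D × D ∩ E ⊆ G × ∃[ K ] (Chamber Δ K × ¬ D ≼ K × G ⊆ K))
    shelling⇒facet _≼_ lin shelling D-ch E-ch E≼D E≢D with position D-ch | position E-ch
    ... | j , refl | i , refl with shelling j i (linearExtension-< _≼_ lin E≼D E≢D)
    ...   | G , G⋖D , D∩E⊆G , k , k<j , G⊆K =
      G , G⋖D , D∩E⊆G , lookup list k , All.lookup allCh (∈-lookup k) ,
      (λ D≼K → <⇒≱ k<j (lin j k D≼K)) , G⊆K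

    linearExtension-isShelling :
      ∀ _≼_ → IsLinearExtension Δ _≼_ O →
      (∀ {D E} → Chamber Δ D → Chamber Δ E → ¬ D ≼ E →
         ∃[ G ] (_⋖_ Δ G D × D ∩ E ⊆ G × ∃[ K ] (Chamber Δ K × K ≼ D × K ≢ D × G ⊆ K))) →
      IsShelling Δ O
    linearExtension-isShelling _≼_ lin witness j i i<j
      with witness (All.lookup allCh (∈-lookup j)) (All.lookup allCh (∈-lookup i))
                   (λ Dj≼Di → <⇒≱ i<j (lin j i Dj≼Di))
    ... | G , G⋖D , D∩E⊆G , K , K-ch , K≼D , K≢D , G⊆K with position K-ch
    ...   | k , refl = G , G⋖D , D∩E⊆G , k , linearExtension-< _≼_ lin K≼D K≢D , G⊆K

  linearChamberOrder : ∀ _≼_ → (∀ D E → Dec (D ≼ E)) → IsPartialOrderOnChambers Δ _≼_ →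
                       Σ (ChamberOrder Δ) (IsLinearExtension Δ _≼_)
  linearChamberOrder _≼_ _≼?_ (refl′ , antisym , trans′) = order , linear
    where
    open FinitePoset _≟ₛ_ _≼_ _≼?_ (refl′ _) (antisym _ _) (trans′ _ _ _)
    open LinearExtension (linearExtension chambers chambers-chamber)
    order : ChamberOrder Δ
    order = record
      { list     = list
      ; allCh    = All.tabulate λ D∈ → All.lookup chambers-chamber (⊆xs D∈)
      ; complete = λ D D-ch → ⊇xs (∈-chambers D-ch)
      ; unique   = AllPairs.map proj₁ sorted
      }
    linear : IsLinearExtension Δ _≼_ order
    linear i j i≼j = ≮⇒≥ λ j<i → proj₂ (AllPairs-lookup sorted j<i) i≼j

  module FromProjections
    (proj : Subset n → Subset n → Subset n)
    (proj-chamber : ∀ F C → Face Δ F → Chamber Δ C → Chamber Δ (proj F C))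
    (P1i : ∀ F C → Face Δ F → Chamber Δ C → F ⊆ proj F C)
    (P1ii : ∀ F C → Face Δ F → Chamber Δ C → F ⊆ C → proj F C ≡ C)
    (P1iii : ∀ F G C D → Face Δ F → Face Δ G → Chamber Δ C → Chamber Δ D →
             proj F C ≡ D → F ⊆ G → G ⊆ D → proj G C ≡ D)
    (P2 : ∀ F C D → Face Δ F → Chamber Δ C → Chamber Δ D → F ⊆ D →
          (∀ G → Face Δ G → F ⊆ G → _⋖_ Δ G D → proj G C ≡ D) → proj F C ≡ D)
    (P3 : ∀ F C C₁ D → Face Δ F → Chamber Δ C → Chamber Δ D →
          proj F C ≡ D → WeakGallery Δ proj C C₁ D → proj F C₁ ≡ D)
    where

    Essential : Subset n → Subset n → Fin n → Set
    Essential C D v = v ∈ D × proj (D - v) C ≢ D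

    essential? : ∀ C D v → Dec (Essential C D v)
    essential? C D v = v ∈? D ×-dec ¬? (proj (D - v) C ≟ₛ D)

    res : Subset n → Subset n → Subset n
    res C D = select (essential? C D)

    res⊆ : ∀ C D → res C D ⊆ D
    res⊆ C D v∈res = proj₁ (∈-select⁻ (essential? C D) v∈res)

    proj≡⇒res⊆ : ∀ {F C D} → Face Δ F → Chamber Δ C → Chamber Δ D → F ⊆ D →
                 proj F C ≡ D → res C D ⊆ F
    proj≡⇒res⊆ {F} {C} {D} F-face C-ch D-ch F⊆D FC≡D {v} v∈res =
      decidable-stable (v ∈? F) λ v∉F → proj₂ (∈-select⁻ (essential? C D) v∈res)
        (P1iii F (D - v) C D F-face (⊆chamber⇒face D-ch (p-x⊆p D v)) C-ch D-ch FC≡D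
               (p⊆q∧x∉p⇒p⊆q-x F⊆D v∉F) (p-x⊆p D v))

    res⊆⇒proj≡ : ∀ {F C D} → Face Δ F → Chamber Δ C → Chamber Δ D → F ⊆ D →
                 res C D ⊆ F → proj F C ≡ D
    res⊆⇒proj≡ {F} {C} {D} F-face C-ch D-ch F⊆D res⊆F = P2 F C D F-face C-ch D-ch F⊆D facet
      where
      facet : ∀ G → Face Δ G → F ⊆ G → _⋖_ Δ G D → proj G C ≡ D
      facet G _ F⊆G G⋖D with ⋖⇒≡D-v G⋖D
      ... | v , v∈D , refl = decidable-stable (proj (D - v) C ≟ₛ D) λ D-vC≢D →
        x∉p-x D (F⊆G (res⊆F (∈-select⁺ (essential? C D) (v∈D , D-vC≢D))))

    res-face : ∀ C D → Chamber Δ C → Chamber Δ D → Face Δ (res C D)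
    res-face C D _ D-ch = ⊆chamber⇒face D-ch (res⊆ C D)

    res-self : ∀ C → Chamber Δ C → res C C ≡ ⊥
    res-self C C-ch = ⊆-antisym res⊆⊥ (⊆-min (res C C))
      where
      res⊆⊥ = proj≡⇒res⊆ emptyFace C-ch C-ch (⊆-min C) (P1ii ⊥ C emptyFace C-ch (⊆-min C))

    res-interval : ∀ C F → Chamber Δ C → Face Δ F →
                   ∃[ D ] (InInterval res C F D × (∀ D′ → Chamber Δ D′ → res C D′ ⊆ F → F ⊆ D′ → D′ ≡ D))
    res-interval C F C-ch F-face = proj F C , (D-ch , proj≡⇒res⊆ F-face C-ch D-ch F⊆D refl , F⊆D) ,
      λ D′ D′-ch res⊆F F⊆D′ → sym (res⊆⇒proj≡ F-face C-ch D′-ch F⊆D′ res⊆F)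
      where
      D-ch = proj-chamber F C F-face C-ch
      F⊆D = P1i F C F-face C-ch

    rchain⇒gallery : ∀ {C C₁ D} → Chamber Δ C → RChain Δ res C C₁ D → WeakGallery Δ proj C C₁ D
    rchain⇒gallery C-ch (single D-ch) = single D-ch
    rchain⇒gallery {C} C-ch (step {C₁} C₁-ch res⊆C₂ chain) =
      step (res C C₁) C₁-ch (res-face C C₁ C-ch C₁-ch)
           (res⊆⇒proj≡ (res-face C C₁ C-ch C₁-ch) C-ch C₁-ch (res⊆ C C₁) ⊆-refl)
           (res⊆ C C₁) res⊆C₂ (rchain⇒gallery C-ch chain)

    res-R3 : ∀ C C₁ D → Chamber Δ C → RChain Δ res C C₁ D → res C₁ D ⊆ res C D
    res-R3 C C₁ D C-ch chain =
      proj≡⇒res⊆ F-face (rchain-start chain) D-ch (res⊆ C D)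
        (P3 F C C₁ D F-face C-ch D-ch (res⊆⇒proj≡ F-face C-ch D-ch (res⊆ C D) ⊆-refl)
            (rchain⇒gallery C-ch chain))
      where
      F = res C D
      D-ch = rchain-end chain
      F-face = res-face C D C-ch D-ch

    hasRestrictions : HasRestrictions Δ
    hasRestrictions = res , res-face , res-self , (λ C D _ _ → res⊆ C D) , res-interval , res-R3

  module FromRestrictions
    (res : Subset n → Subset n → Subset n)
    (res-face : ∀ C D → Chamber Δ C → Chamber Δ D → Face Δ (res C D))
    (res-self : ∀ C → Chamber Δ C → res C C ≡ ⊥)
    (res⊆ : ∀ C D → Chamber Δ C → Chamber Δ D → res C D ⊆ D)
    (res-interval : ∀ C F → Chamber Δ C → Face Δ F →
                    ∃[ D ] (InInterval res C F D × (∀ D′ → Chamber Δ D′ → res C D′ ⊆ F → F ⊆ D′ → D′ ≡ D)))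
    (R3 : ∀ C C₁ D → Chamber Δ C → RChain Δ res C C₁ D → res C₁ D ⊆ res C D)
    where

    interval-unique : ∀ {C F D D′} → Chamber Δ C → Face Δ F →
                      InInterval res C F D → InInterval res C F D′ → D ≡ D′
    interval-unique {C} {F} {D} {D′} C-ch F-face (D-ch , resD⊆F , F⊆D) (D′-ch , resD′⊆F , F⊆D′) =
      trans (unique D D-ch resD⊆F F⊆D) (sym (unique D′ D′-ch resD′⊆F F⊆D′))
      where unique = proj₂ (proj₂ (res-interval C F C-ch F-face))

    self-interval : ∀ {C F} → Chamber Δ C → F ⊆ C → InInterval res C F C
    self-interval {C} {F} C-ch F⊆C = C-ch , subst (_⊆ F) (sym (res-self C C-ch)) (⊆-min F) , F⊆C

    inInterval? : ∀ C F D → Dec (InInterval res C F D)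
    inInterval? C F D = chamber? D ×-dec (res C D ⊆? F ×-dec F ⊆? D)

    proj : Subset n → Subset n → Subset n
    proj F C with anySubset? (inInterval? C F)
    ... | yes (D , _) = D
    ... | no _        = ⊥

    proj-interval : ∀ {F C} → Face Δ F → Chamber Δ C → InInterval res C F (proj F C)
    proj-interval {F} {C} F-face C-ch with anySubset? (inInterval? C F)
    ... | yes (_ , D∈) = D∈
    ... | no ∄D        = contradiction (map₂ proj₁ (res-interval C F C-ch F-face)) ∄D

    proj≡⇒inInterval : ∀ {F C D} → Face Δ F → Chamber Δ C → proj F C ≡ D → InInterval res C F D
    proj≡⇒inInterval F-face C-ch refl = proj-interval F-face C-ch

    inInterval⇒proj≡ : ∀ {F C D} → Face Δ F → Chamber Δ C → InInterval res C F D → proj F C ≡ D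
    inInterval⇒proj≡ F-face C-ch = interval-unique C-ch F-face (proj-interval F-face C-ch)

    proj-P1iii : ∀ F G C D → Face Δ F → Face Δ G → Chamber Δ C → Chamber Δ D →
                 proj F C ≡ D → F ⊆ G → G ⊆ D → proj G C ≡ D
    proj-P1iii F G C D F-face G-face C-ch D-ch FC≡D F⊆G G⊆D with proj≡⇒inInterval F-face C-ch FC≡D
    ... | _ , res⊆F , _ = inInterval⇒proj≡ G-face C-ch (D-ch , ⊆-trans res⊆F F⊆G , G⊆D)

    proj-P2 : ∀ F C D → Face Δ F → Chamber Δ C → Chamber Δ D → F ⊆ D →
              (∀ G → Face Δ G → F ⊆ G → _⋖_ Δ G D → proj G C ≡ D) → proj F C ≡ D
    proj-P2 F C D F-face C-ch D-ch F⊆D facets = inInterval⇒proj≡ F-face C-ch (D-ch , res⊆F , F⊆D)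
      where
      res⊆F : res C D ⊆ F
      res⊆F {v} v∈res = decidable-stable (v ∈? F) λ v∉F →
        let D-v-face = ⊆chamber⇒face D-ch (p-x⊆p D v)
            D-vC≡D   = facets (D - v) D-v-face (p⊆q∧x∉p⇒p⊆q-x F⊆D v∉F) (D-v⋖D (res⊆ C D C-ch D-ch v∈res))
        in x∉p-x D (proj₁ (proj₂ (proj≡⇒inInterval D-v-face C-ch D-vC≡D)) v∈res)

    gallery⇒rchain : ∀ {C C₁ D} → Chamber Δ C → WeakGallery Δ proj C C₁ D → RChain Δ res C C₁ D
    gallery⇒rchain C-ch (single D-ch) = single D-ch
    gallery⇒rchain C-ch (step F C₁-ch F-face FC≡C₁ _ F⊆C₂ gallery)
      with proj≡⇒inInterval F-face C-ch FC≡C₁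
    ... | _ , res⊆F , _ = step C₁-ch (⊆-trans res⊆F F⊆C₂) (gallery⇒rchain C-ch gallery)

    proj-P3 : ∀ F C C₁ D → Face Δ F → Chamber Δ C → Chamber Δ D →
              proj F C ≡ D → WeakGallery Δ proj C C₁ D → proj F C₁ ≡ D
    proj-P3 F C C₁ D F-face C-ch D-ch FC≡D gallery with proj≡⇒inInterval F-face C-ch FC≡D
    ... | _ , res⊆F , F⊆D = inInterval⇒proj≡ F-face (gallery-start gallery)
      (D-ch , ⊆-trans (R3 C C₁ D C-ch (gallery⇒rchain C-ch gallery)) res⊆F , F⊆D)

    hasProjections : HasProjections Δ
    hasProjections = proj
      , (λ F C F-face C-ch → proj₁ (proj-interval F-face C-ch))
      , (λ F C F-face C-ch → proj₂ (proj₂ (proj-interval F-face C-ch)))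
      , (λ F C F-face C-ch F⊆C → inInterval⇒proj≡ F-face C-ch (self-interval C-ch F⊆C))
      , proj-P1iii , proj-P2 , proj-P3

    rchain-step : ∀ {C D E} → Chamber Δ D → Chamber Δ E → res C D ⊆ E → RChain Δ res C D E
    rchain-step D-ch E-ch res⊆E = step D-ch res⊆E (single E-ch)

    _++_ : ∀ {C D D₁ D₂} → RChain Δ res C D D₁ → RChain Δ res C D₁ D₂ → RChain Δ res C D D₂
    single _           ++ chain′ = chain′
    step D-ch res⊆ chain ++ chain′ = step D-ch res⊆ (chain ++ chain′)

    res⊆∧rchain⇒≡ : ∀ {C D E} → Chamber Δ C → Chamber Δ D → Chamber Δ E →
                    res C D ⊆ E → RChain Δ res C E D → D ≡ E
    res⊆∧rchain⇒≡ {C} {D} {E} C-ch D-ch E-ch resCD⊆E E→D =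
      interval-unique E-ch (res-face E D E-ch D-ch)
        (D-ch , ⊆-refl , res⊆ E D E-ch D-ch)
        (self-interval E-ch (⊆-trans (R3 C E D C-ch E→D) resCD⊆E))

    rchain-antisym : ∀ {C D E} → Chamber Δ C → RChain Δ res C D E → RChain Δ res C E D → D ≡ E
    rchain-antisym C-ch (single _) _ = refl
    rchain-antisym C-ch (step D-ch res⊆D₁ D₁→E) E→D
      with res⊆∧rchain⇒≡ C-ch D-ch (rchain-start D₁→E) res⊆D₁ (D₁→E ++ E→D)
    ... | refl = rchain-antisym C-ch D₁→E E→D

    rchain-partialOrder : ∀ C → Chamber Δ C → IsPartialOrderOnChambers Δ (RChain Δ res C)
    rchain-partialOrder C C-ch =
      (λ D D-ch → single D-ch) , (λ _ _ _ _ → rchain-antisym C-ch) , (λ _ _ _ _ _ _ → _++_)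

    inInterval⇒minimal : ∀ {C F D} → Chamber Δ C → InInterval res C F D →
                         MinimalAbove Δ (RChain Δ res C) F D
    inInterval⇒minimal C-ch (D-ch , res⊆F , F⊆D) = D-ch , F⊆D , λ E E-ch F⊆E E→D →
      sym (rchain-antisym C-ch (rchain-step D-ch E-ch (⊆-trans res⊆F F⊆E)) E→D)

    rchain-S1 : ∀ C F → Chamber Δ C → Face Δ F →
                ∃[ m ] (MinimalAbove Δ (RChain Δ res C) F m ×
                        (∀ m′ → MinimalAbove Δ (RChain Δ res C) F m′ → m′ ≡ m))
    rchain-S1 C F C-ch F-face with res-interval C F C-ch F-face
    ... | D , D∈@(D-ch , res⊆F , F⊆D) , _ = D , inInterval⇒minimal C-ch D∈ ,
      λ { m′ (m′-ch , F⊆m′ , m′-min) →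
            sym (m′-min D D-ch F⊆D (rchain-step D-ch m′-ch (⊆-trans res⊆F F⊆m′))) }

    rchain-shellingWitness :
      ∀ {C D E} → Chamber Δ C → Chamber Δ D → Chamber Δ E → ¬ RChain Δ res C D E →
      ∃[ G ] (_⋖_ Δ G D × D ∩ E ⊆ G × ∃[ K ] (Chamber Δ K × RChain Δ res C K D × K ≢ D × G ⊆ K))
    rchain-shellingWitness {C} {D} {E} C-ch D-ch E-ch D↛E
      with p⊈q⇒∃∈∉ {p = res C D} {q = D ∩ E}
             (λ res⊆D∩E → D↛E (rchain-step D-ch E-ch (⊆-trans res⊆D∩E (p∩q⊆q D E))))
    ... | v , v∈res , v∉D∩E with res-interval C (D - v) C-ch (⊆chamber⇒face D-ch (p-x⊆p D v))
    ...   | K , (K-ch , resK⊆D-v , D-v⊆K) , _ =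
      D - v , D-v⋖D (res⊆ C D C-ch D-ch v∈res) , p⊆q∧x∉p⇒p⊆q-x (p∩q⊆p D E) v∉D∩E ,
      K , K-ch , rchain-step K-ch D-ch (⊆-trans resK⊆D-v (p-x⊆p D v)) , K≢D , D-v⊆K
      where
      K≢D : K ≢ D
      K≢D refl = x∉p-x D (resK⊆D-v v∈res)

    rchain-S3 : ∀ C D D₁ D₂ → Chamber Δ C → Chamber Δ D → Chamber Δ D₁ → Chamber Δ D₂ →
                RChain Δ res C D D₁ → RChain Δ res C D₁ D₂ → RChain Δ res D D₁ D₂
    rchain-S3 C D _ _ C-ch _ _ _ = go
      where
      go : ∀ {A B} → RChain Δ res C D A → RChain Δ res C A B → RChain Δ res D A B
      go _   (single B-ch)             = single B-ch
      go D→A (step A-ch res⊆A′ A′→B) =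
        step A-ch (⊆-trans (R3 C D _ C-ch D→A) res⊆A′)
             (go (D→A ++ rchain-step A-ch (rchain-start A′→B) res⊆A′) A′→B)

    hasShellingOrders : HasShellingOrders Δ
    hasShellingOrders = RChain Δ res
      , rchain-partialOrder
      , rchain-S1
      , (λ C C-ch → inInterval⇒minimal C-ch (self-interval C-ch (⊆-min C)))
      , (λ C C-ch O lin → linearExtension-isShelling O (RChain Δ res C) lin (rchain-shellingWitness C-ch))
      , rchain-S3

  module FromShellingOrders
    (ord : Subset n → Subset n → Subset n → Set)
    (ord-partialOrder : ∀ C → Chamber Δ C → IsPartialOrderOnChambers Δ (ord C))
    (S1 : ∀ C F → Chamber Δ C → Face Δ F →
          ∃[ m ] (MinimalAbove Δ (ord C) F m × (∀ m′ → MinimalAbove Δ (ord C) F m′ → m′ ≡ m)))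
    (S1-∅ : ∀ C → Chamber Δ C → MinimalAbove Δ (ord C) ⊥ C)
    (S2 : ∀ C → Chamber Δ C → (O : ChamberOrder Δ) → IsLinearExtension Δ (ord C) O → IsShelling Δ O)
    (S3 : ∀ C D D₁ D₂ → Chamber Δ C → Chamber Δ D → Chamber Δ D₁ → Chamber Δ D₂ →
          ord C D D₁ → ord C D₁ D₂ → ord D D₁ D₂)
    where

    proj : Subset n → Subset n → Subset n
    proj F C with T? (isFace F) | chamber? C
    ... | yes F-face | yes C-ch = proj₁ (S1 C F C-ch F-face)
    ... | _          | _        = ⊥

    proj-spec : ∀ {F C} → Face Δ F → Chamber Δ C →
                MinimalAbove Δ (ord C) F (proj F C) × (∀ m → MinimalAbove Δ (ord C) F m → m ≡ proj F C)
    proj-spec {F} {C} F-face C-ch with T? (isFace F) | chamber? C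
    ... | yes F-face′ | yes C-ch′ = proj₂ (S1 C F C-ch′ F-face′)
    ... | no ¬F-face  | _         = contradiction F-face ¬F-face
    ... | yes _       | no ¬C-ch  = contradiction C-ch ¬C-ch

    proj-minimal : ∀ {F C} → Face Δ F → Chamber Δ C → MinimalAbove Δ (ord C) F (proj F C)
    proj-minimal F-face C-ch = proj₁ (proj-spec F-face C-ch)

    minimal⇒≡proj : ∀ {F C m} → Face Δ F → Chamber Δ C → MinimalAbove Δ (ord C) F m → proj F C ≡ m
    minimal⇒≡proj F-face C-ch m-min = sym (proj₂ (proj-spec F-face C-ch) _ m-min)

    proj-P1iii : ∀ F G C D → Face Δ F → Face Δ G → Chamber Δ C → Chamber Δ D →
                 proj F C ≡ D → F ⊆ G → G ⊆ D → proj G C ≡ D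
    proj-P1iii F G C D F-face G-face C-ch _ refl F⊆G G⊆D =
      minimal⇒≡proj G-face C-ch (minimalAbove-⊆ {ord C} F⊆G G⊆D (proj-minimal F-face C-ch))

    ord-refl : ∀ {C D} → Chamber Δ C → Chamber Δ D → ord C D D
    ord-refl C-ch = proj₁ (ord-partialOrder _ C-ch) _

    ord-antisym : ∀ {C D E} → Chamber Δ C → Chamber Δ D → Chamber Δ E → ord C D E → ord C E D → D ≡ E
    ord-antisym C-ch = proj₁ (proj₂ (ord-partialOrder _ C-ch)) _ _

    ord-trans : ∀ {C D E K} → Chamber Δ C → Chamber Δ D → Chamber Δ E → Chamber Δ K →
                ord C D E → ord C E K → ord C D K
    ord-trans C-ch = proj₂ (proj₂ (ord-partialOrder _ C-ch)) _ _ _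

    module WithDecidableOrder {C} (C-ch : Chamber Δ C) (ord? : ∀ D E → Dec (ord C D E)) where

      open FinitePoset _≟ₛ_ (ord C) ord? (ord-refl C-ch) (ord-antisym C-ch) (ord-trans C-ch)
        using (minimalBelow)

      proj-least : ∀ {F E} → Face Δ F → Chamber Δ E → F ⊆ E → ord C (proj F C) E
      proj-least {F} {E} F-face E-ch F⊆E
        with minimalBelow (F ⊆?_) chambers-chamber (∈-chambers E-ch) F⊆E
      ... | m , m∈ , F⊆m , m≼E , m-min = subst (λ X → ord C X E) (sym FC≡m) m≼E
        where
        FC≡m : proj F C ≡ m
        FC≡m = minimal⇒≡proj F-face C-ch
          (All.lookup chambers-chamber m∈ , F⊆m , λ Y Y-ch F⊆Y Y≼m → m-min (∈-chambers Y-ch) F⊆Y Y≼m)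

      proj-P2 : ∀ {F D} → Face Δ F → Chamber Δ D → F ⊆ D →
                (∀ G → Face Δ G → F ⊆ G → _⋖_ Δ G D → proj G C ≡ D) → proj F C ≡ D
      proj-P2 {F} {D} F-face D-ch F⊆D facets = decidable-stable (proj F C ≟ₛ D) λ FC≢D →
        let O , linear = linearChamberOrder (ord C) ord? (ord-partialOrder C C-ch)
            E-ch , F⊆E , _ = proj-minimal F-face C-ch
            G , G⋖D , D∩E⊆G , K , K-ch , D⋠K , G⊆K =
              shelling⇒facet O (ord C) linear (S2 C C-ch O linear) D-ch E-ch (proj-least F-face D-ch F⊆D) FC≢D
            G-face = ⊆chamber⇒face D-ch (proj₁ G⋖D)
            GC≡D = facets G G-face (λ x∈F → D∩E⊆G (x∈p∩q⁺ (F⊆D x∈F , F⊆E x∈F))) G⋖D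
        in D⋠K (subst (λ X → ord C X K) GC≡D (proj-least G-face K-ch G⊆K))

      gallery⇒ord : ∀ {C₁ D} → Chamber Δ D → WeakGallery Δ proj C C₁ D → ord C C₁ D
      gallery⇒ord D-ch (single C₁-ch) = ord-refl C-ch C₁-ch
      gallery⇒ord D-ch (step F C₁-ch F-face refl _ F⊆C₂ gallery) =
        ord-trans C-ch C₁-ch (gallery-start gallery) D-ch (proj-least F-face (gallery-start gallery) F⊆C₂)
                  (gallery⇒ord D-ch gallery)

      proj-P3 : ∀ {F C₁ D} → Face Δ F → Chamber Δ D →
                proj F C ≡ D → WeakGallery Δ proj C C₁ D → proj F C₁ ≡ D
      proj-P3 {F} {C₁} {D} F-face D-ch refl gallery =
        minimal⇒≡proj F-face C₁-ch (D-ch , F⊆D , λ E E-ch F⊆E E≼D → ord-antisym C₁-ch E-ch D-ch E≼D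
          (S3 C C₁ D E C-ch C₁-ch D-ch E-ch (gallery⇒ord D-ch gallery) (proj-least F-face E-ch F⊆E)))
        where
        C₁-ch = gallery-start gallery
        F⊆D = proj₁ (proj₂ (proj-minimal F-face C-ch))

    -- ord C need not be decidable, but all that is derived from it below are
    -- equalities of subsets, which are decidable and hence ¬¬-stable.
    ord-decidable : ∀ C → ¬ ¬ (∀ D E → Dec (ord C D E))
    ord-decidable C = ¬¬-∀-Subset λ D → ¬¬-∀-Subset λ E → ¬¬-excluded-middle

    proj-P2 : ∀ F C D → Face Δ F → Chamber Δ C → Chamber Δ D → F ⊆ D →
              (∀ G → Face Δ G → F ⊆ G → _⋖_ Δ G D → proj G C ≡ D) → proj F C ≡ D
    proj-P2 F C D F-face C-ch D-ch F⊆D facets = decidable-stable (proj F C ≟ₛ D) λ FC≢D →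
      ord-decidable C λ ord? → FC≢D (WithDecidableOrder.proj-P2 C-ch ord? F-face D-ch F⊆D facets)

    proj-P3 : ∀ F C C₁ D → Face Δ F → Chamber Δ C → Chamber Δ D →
              proj F C ≡ D → WeakGallery Δ proj C C₁ D → proj F C₁ ≡ D
    proj-P3 F C C₁ D F-face C-ch D-ch FC≡D gallery = decidable-stable (proj F C₁ ≟ₛ D) λ FC₁≢D →
      ord-decidable C λ ord? → FC₁≢D (WithDecidableOrder.proj-P3 C-ch ord? F-face D-ch FC≡D gallery)

    hasProjections : HasProjections Δ
    hasProjections = proj
      , (λ F C F-face C-ch → proj₁ (proj-minimal F-face C-ch))
      , (λ F C F-face C-ch → proj₁ (proj₂ (proj-minimal F-face C-ch)))
      , (λ F C F-face C-ch F⊆C →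
           minimal⇒≡proj F-face C-ch (minimalAbove-⊆ {ord C} (⊆-min F) F⊆C (S1-∅ C C-ch)))
      , proj-P1iii , proj-P2 , proj-P3

  projections⇒restrictions : HasProjections Δ → HasRestrictions Δ
  projections⇒restrictions (proj , P-chamber , P1i , P1ii , P1iii , P2 , P3) =
    FromProjections.hasRestrictions proj P-chamber P1i P1ii P1iii P2 P3

  restrictions⇒projections : HasRestrictions Δ → HasProjections Δ
  restrictions⇒projections (res , R-face , R1 , R⊆ , R2 , R3) =
    FromRestrictions.hasProjections res R-face R1 R⊆ R2 R3

  restrictions⇒shellingOrders : HasRestrictions Δ → HasShellingOrders Δ
  restrictions⇒shellingOrders (res , R-face , R1 , R⊆ , R2 , R3) =
    FromRestrictions.hasShellingOrders res R-face R1 R⊆ R2 R3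

  shellingOrders⇒projections : HasShellingOrders Δ → HasProjections Δ
  shellingOrders⇒projections (ord , S-partialOrder , S1 , S1-∅ , S2 , S3) =
    FromShellingOrders.hasProjections ord S-partialOrder S1 S1-∅ S2 S3

theorem4p2 : (Δ : Complex) → Pure Δ →
    (HasProjections Δ ⇔ HasRestrictions Δ) × (HasRestrictions Δ ⇔ HasShellingOrders Δ)
theorem4p2 Δ _ =
    mk⇔ (projections⇒restrictions Δ) (restrictions⇒projections Δ)
  , mk⇔ (restrictions⇒shellingOrders Δ) (projections⇒restrictions Δ ∘ shellingOrders⇒projections Δ)
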